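{- Let $G$ and $H$ be connected finite simple graphs, each with at least two vertices. Then $$\rho_o(G\square H)\geq \max\{\rho(G)\rho_o(H),\ \rho(H)\rho_o(G),\ \eta_H\rho_o(G)+\eta_G^H,\ \eta_G\rho_o(H)+\eta_H^G\},$$ where $\eta_X=\lceil(\mathrm{diam}(X)+1)/3\rceil$ for a graph $X$, and for graphs $X,Y$, $\eta_X^Y=1$ if $X\neq K_2$ and $\mathrm{diam}(Y)\equiv 2 \pmod 3$, and $\eta_X^Y=0$ otherwise.
   Context: For a graph $G$ and $v\in V(G)$, $N_G(v)$ and $N_G[v]=N_G(v)\cup\{v\}$ are the open and closed neighborhoods. A packing is a set $P\subseteq V(G)$ with $N_G[u]\cap N_G[v]=\emptyset$ for distinct $u,v\in P$; $\rho(G)$ is the maximum size of a packing. An open packing is a set $P\subseteq V(G)$ with $N_G(u)\cap N_G(v)=\emptyset$ for distinct $u,v\in P$; $\rho_o(G)$ is the maximum size of an open packing. $\mathrm{diam}$ denotes the diameter. The Cartesian product $G\square H$ has vertex set $V(G)\times V(H)$, with $(g,h)$ adjacent to $(g',h')$ iff either $g=g'$ and $hh'\in E(H)$, or $h=h'$ and $gg'\in E(G)$. -}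

module Defs where

open import Data.Nat using (ℕ; zero; suc; _+_; _*_; _≤_; _/_)
open import Data.Fin using (Fin)
open import Data.Product using (Σ; ∃; _×_; _,_)
open import Data.Sum using (_⊎_)
open import Data.List using (List; length)
open import Data.List.Membership.Propositional using (_∈_)
open import Data.List.Relation.Unary.Unique.Propositional using (Unique)
open import Relation.Binary.PropositionalEquality using (_≡_; _≢_)
open import Relation.Nullary using (¬_; Dec)

record Graph : Set₁ where
  field
    n      : ℕ
    _~_    : Fin n → Fin n → Set
    ~-dec  : ∀ u v → Dec (u ~ v)
    ~-sym  : ∀ {u v} → u ~ v → v ~ u
    ~-irr  : ∀ {u} → ¬ (u ~ u)

open Graph public

module _ {V : Set} (E : V → V → Set) where

  InOpenNbhd : V → V → Set
  InOpenNbhd v w = E v w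

  InClosedNbhd : V → V → Set
  InClosedNbhd v w = (w ≡ v) ⊎ E v w

  IsPacking : List V → Set
  IsPacking P = Unique P ×
    (∀ {u v} → u ∈ P → v ∈ P → u ≢ v →
       ∀ w → ¬ (InClosedNbhd u w × InClosedNbhd v w))

  IsOpenPacking : List V → Set
  IsOpenPacking P = Unique P ×
    (∀ {u v} → u ∈ P → v ∈ P → u ≢ v →
       ∀ w → ¬ (InOpenNbhd u w × InOpenNbhd v w))

  IsPackingNumber : ℕ → Set
  IsPackingNumber k =
    (Σ (List V) λ P → IsPacking P × length P ≡ k) ×
    (∀ P → IsPacking P → length P ≤ k)

  IsOpenPackingNumber : ℕ → Set
  IsOpenPackingNumber k =
    (Σ (List V) λ P → IsOpenPacking P × length P ≡ k) ×
    (∀ P → IsOpenPacking P → length P ≤ k)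

  data Walk : V → V → ℕ → Set where
    [] : ∀ {u} → Walk u u zero
    _∷_ : ∀ {u v w k} → E u v → Walk v w k → Walk u w (suc k)

  Connected : Set
  Connected = ∀ u v → ∃ λ k → Walk u v k

  IsDist : V → V → ℕ → Set
  IsDist u v d = Walk u v d × (∀ k → Walk u v k → d ≤ k)

  IsDiam : ℕ → Set
  IsDiam D = (∃ λ u → ∃ λ v → IsDist u v D) ×
             (∀ u v d → IsDist u v d → d ≤ D)

□-Adj : (G H : Graph) → (Fin (n G) × Fin (n H)) → (Fin (n G) × Fin (n H)) → Set
□-Adj G H (g , h) (g' , h') = (g ≡ g' × _~_ H h h') ⊎ (h ≡ h' × _~_ G g g')

IsK2 : Graph → Set
IsK2 G = Σ (n G ≡ 2) λ _ → ∀ (u v : Fin (n G)) → u ≢ v → _~_ G u v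

-- η_X = ⌈(diam X + 1)/3⌉  (ceiling written as floor((D+1+2)/3))
η : ℕ → ℕ
η D = (D + 1 + 2) / 3

-- The vertices w₀, w₃, w₆, … of a diametral path of a graph lie pairwise at
-- distance at least 3, so they form a packing of size η.  If Q is a packing
-- of one factor and P an open packing of the other, Q × P is an open packing
-- of G □ H: a common neighbour of two of its vertices would be a common
-- neighbour of two vertices of P, or lie within distance 2 of two vertices
-- of Q.  When diam H ≡ 2 (mod 3), the
-- far end of the diametral path is at distance at least 2 from every
-- milestone w_{3i}, and pairing it with a vertex of G outside the open
-- packing adds one more vertex.  Such a vertex exists unless G = K₂, since
-- an open packing covering a connected graph leaves every vertex at most
-- one neighbour.
module Submission where

open import Defs
open import Data.Nat using (ℕ; _+_; _*_; _≤_; _%_; _≥_)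
open import Data.Product using (_×_)
open import Relation.Binary.PropositionalEquality using (_≡_)
open import Relation.Nullary using (¬_)

open import Data.Nat using (zero; suc; _<_; _∸_; _/_; z≤n; s≤s; s≤s⁻¹)
open import Data.Nat.Properties
open import Data.Nat.DivMod using (m/n*n≤m; m≡m%n+[m/n]*n)
open import Data.Fin using (Fin; zero; suc; toℕ) renaming (_≟_ to _≟ᶠ_)
open import Data.Fin.Properties using (toℕ-injective; toℕ<n; ¬∀⟶∃¬)
open import Data.Product using (Σ; ∃; _,_; proj₁; proj₂; swap)
open import Data.Sum using (_⊎_; inj₁; inj₂)
open import Data.Empty using (⊥; ⊥-elim)
open import Data.List using (List; []; _∷_; length; map; cartesianProduct; allFin; _++_)
open import Data.List.Properties using (length-map; length-++; length-tabulate)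
open import Data.List.Membership.Propositional using (_∈_)
open import Data.List.Membership.Propositional.Properties using (∈-map⁻; ∈-cartesianProductWith⁻)
open import Data.List.Membership.DecPropositional using (_∈?_)
open import Data.List.Relation.Unary.All.Properties using (¬Any⇒All¬)
open import Data.List.Relation.Unary.AllPairs using (_∷_)
open import Data.List.Relation.Unary.Any using (here; there)
open import Data.List.Relation.Unary.Unique.Propositional.Properties using (cartesianProduct⁺; map⁺; allFin⁺)
open import Relation.Binary.Definitions using (Symmetric)
open import Relation.Nullary using (yes; no)
open import Relation.Binary.PropositionalEquality using (refl; sym; trans; cong; cong₂; subst; _≢_; module ≡-Reasoning)

3*-≤-3*+2⇒≤ : ∀ i j → 3 * i ≤ 3 * j + 2 → i ≤ j
3*-≤-3*+2⇒≤ i j 3i≤3j+2 = s≤s⁻¹ (*-cancelˡ-< 3 i (suc j) (begin-strict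
  3 * i      ≤⟨ 3i≤3j+2 ⟩
  3 * j + 2  <⟨ +-monoʳ-< (3 * j) (n<1+n 2) ⟩
  3 * j + 3  ≡⟨ +-comm (3 * j) 3 ⟩
  3 + 3 * j  ≡⟨ *-suc 3 j ⟨
  3 * suc j  ∎))
  where open ≤-Reasoning

<η⇒3*≤ : ∀ D i → i < η D → 3 * i ≤ D
<η⇒3*≤ D i i<ηD = +-cancelʳ-≤ 3 (3 * i) D (begin
  3 * i + 3     ≡⟨ +-comm (3 * i) 3 ⟩
  3 + 3 * i     ≡⟨ cong (3 +_) (*-comm 3 i) ⟩
  suc i * 3     ≤⟨ *-monoˡ-≤ 3 i<ηD ⟩
  η D * 3       ≤⟨ m/n*n≤m (D + 1 + 2) 3 ⟩
  D + 1 + 2     ≡⟨ +-assoc D 1 2 ⟩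
  D + 3         ∎)
  where open ≤-Reasoning

<η⇒3*+2≤ : ∀ D i → D % 3 ≡ 2 → i < η D → 3 * i + 2 ≤ D
<η⇒3*+2≤ D i D%3≡2 i<ηD = begin
  3 * i + 2  ≤⟨ +-monoˡ-≤ 2 (*-monoʳ-≤ 3 i≤q) ⟩
  3 * q + 2  ≡⟨ D≡3q+2 ⟨
  D          ∎
  where
    open ≤-Reasoning
    q : ℕ
    q = D / 3
    D≡3q+2 : D ≡ 3 * q + 2
    D≡3q+2 = begin-equality
      D            ≡⟨ m≡m%n+[m/n]*n D 3 ⟩
      D % 3 + q * 3 ≡⟨ cong₂ _+_ D%3≡2 (*-comm q 3) ⟩
      2 + 3 * q    ≡⟨ +-comm 2 (3 * q) ⟩
      3 * q + 2    ∎
    i≤q : i ≤ q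
    i≤q = 3*-≤-3*+2⇒≤ i q (≤-trans (<η⇒3*≤ D i i<ηD) (≤-reflexive D≡3q+2))

module _ {V : Set} {E : V → V → Set} where

  at : ∀ {u v k} → Walk E u v k → ℕ → V
  at {u} []      _       = u
  at {u} (_ ∷ _) zero    = u
  at     (_ ∷ W) (suc i) = at W i

  at-end : ∀ {u v k} (W : Walk E u v k) → at W k ≡ v
  at-end []      = refl
  at-end (_ ∷ W) = at-end W

  _++ʷ_ : ∀ {u v w a b} → Walk E u v a → Walk E v w b → Walk E u w (a + b)
  []      ++ʷ W′ = W′
  (e ∷ W) ++ʷ W′ = e ∷ (W ++ʷ W′)

  prefix : ∀ {u v k} (W : Walk E u v k) i → i ≤ k → Walk E u (at W i) i
  prefix []      zero    _       = []
  prefix (_ ∷ _) zero    _       = []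
  prefix (e ∷ W) (suc i) (s≤s p) = e ∷ prefix W i p

  suffix : ∀ {u v k} (W : Walk E u v k) i → i ≤ k → Walk E (at W i) v (k ∸ i)
  suffix []      zero    _       = []
  suffix (e ∷ W) zero    _       = e ∷ W
  suffix (_ ∷ W) (suc i) (s≤s p) = suffix W i p

  geodesic-index-bound : ∀ {u v D} → (geo : IsDist E u v D) →
    ∀ a b {m} → b ≤ D → Walk E (at (proj₁ geo) a) (at (proj₁ geo) b) m → b ≤ a + m
  geodesic-index-bound {D = D} (W , shortest) a b {m} b≤D shortcut with b ≤? a
  ... | yes b≤a = ≤-trans b≤a (m≤m+n a m)
  ... | no  b≰a = +-cancelʳ-≤ (D ∸ b) b (a + m) (begin
    b + (D ∸ b)       ≡⟨ m+[n∸m]≡n b≤D ⟩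
    D                 ≤⟨ shortest _ (prefix W a a≤D ++ʷ (shortcut ++ʷ suffix W b b≤D)) ⟩
    a + (m + (D ∸ b)) ≡⟨ +-assoc a m (D ∸ b) ⟨
    a + m + (D ∸ b)   ∎)
    where
      open ≤-Reasoning
      a≤D : a ≤ D
      a≤D = ≤-trans (<⇒≤ (≰⇒> b≰a)) b≤D

  closedNbhd⇒walk : ∀ {a w} → InClosedNbhd E a w → ∃ λ m → m ≤ 1 × Walk E a w m
  closedNbhd⇒walk (inj₁ refl) = 0 , z≤n , []
  closedNbhd⇒walk (inj₂ aw)   = 1 , ≤-refl , aw ∷ []

  closedNbhds-meet⇒walk : Symmetric E → ∀ {a b w} →
    InClosedNbhd E a w → InClosedNbhd E b w → ∃ λ m → m ≤ 2 × Walk E a b m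
  closedNbhds-meet⇒walk E-sym (inj₁ refl) (inj₁ refl) = 0 , z≤n , []
  closedNbhds-meet⇒walk E-sym (inj₁ refl) (inj₂ bw)   = 1 , s≤s z≤n , E-sym bw ∷ []
  closedNbhds-meet⇒walk E-sym (inj₂ aw)   (inj₁ refl) = 1 , s≤s z≤n , aw ∷ []
  closedNbhds-meet⇒walk E-sym (inj₂ aw)   (inj₂ bw)   = 2 , ≤-refl , aw ∷ E-sym bw ∷ []

HasPacking : {V : Set} → (V → V → Set) → ℕ → Set
HasPacking {V} E k = Σ (List V) λ P → IsPacking E P × length P ≡ k

HasOpenPacking : {V : Set} → (V → V → Set) → ℕ → Set
HasOpenPacking {V} E k = Σ (List V) λ P → IsOpenPacking E P × length P ≡ k

module Milestones {V : Set} {E : V → V → Set} (E-sym : Symmetric E)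
                  {u v D} (geo : IsDist E u v D) where

  milestone : Fin (η D) → V
  milestone i = at (proj₁ geo) (3 * toℕ i)

  milestones : List V
  milestones = map milestone (allFin (η D))

  length-milestones : length milestones ≡ η D
  length-milestones = trans (length-map milestone (allFin (η D))) (length-tabulate (λ i → i))

  milestone-walk⇒≤ : ∀ i j {m} → m ≤ 2 → Walk E (milestone i) (milestone j) m → toℕ j ≤ toℕ i
  milestone-walk⇒≤ i j {m} m≤2 w = 3*-≤-3*+2⇒≤ (toℕ j) (toℕ i) (begin
    3 * toℕ j      ≤⟨ geodesic-index-bound geo (3 * toℕ i) (3 * toℕ j) (<η⇒3*≤ D (toℕ j) (toℕ<n j)) w ⟩
    3 * toℕ i + m  ≤⟨ +-monoʳ-≤ (3 * toℕ i) m≤2 ⟩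
    3 * toℕ i + 2  ∎)
    where open ≤-Reasoning

  milestone-close⇒≡ : ∀ {i j} {w} →
    InClosedNbhd E (milestone i) w → InClosedNbhd E (milestone j) w → i ≡ j
  milestone-close⇒≡ {i} {j} ci cj with closedNbhds-meet⇒walk E-sym ci cj | closedNbhds-meet⇒walk E-sym cj ci
  ... | _ , m≤2 , w | _ , m′≤2 , w′ =
    toℕ-injective (≤-antisym (milestone-walk⇒≤ j i m′≤2 w′) (milestone-walk⇒≤ i j m≤2 w))

  milestones-packing : IsPacking E milestones
  milestones-packing = map⁺ milestone-injective (allFin⁺ (η D)) , disjoint
    where
      milestone-injective : ∀ {i j} → milestone i ≡ milestone j → i ≡ j
      milestone-injective {i} e = milestone-close⇒≡ {i} (inj₁ refl) (inj₁ e)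

      disjoint : ∀ {x y} → x ∈ milestones → y ∈ milestones → x ≢ y →
                 ∀ w → ¬ (InClosedNbhd E x w × InClosedNbhd E y w)
      disjoint x∈ y∈ x≢y _ (cx , cy) with ∈-map⁻ milestone x∈ | ∈-map⁻ milestone y∈
      ... | i , _ , refl | j , _ , refl = x≢y (cong milestone (milestone-close⇒≡ {i} {j} cx cy))

  milestones-far-from-end : D % 3 ≡ 2 → ∀ {x} → x ∈ milestones → ¬ InClosedNbhd E x v
  milestones-far-from-end D%3≡2 x∈ cx with ∈-map⁻ milestone x∈
  ... | i , _ , refl with closedNbhd⇒walk cx
  ...   | m , m≤1 , w = <⇒≱ (+-monoʳ-< (3 * toℕ i) (s≤s m≤1)) (begin
    3 * toℕ i + 2  ≤⟨ <η⇒3*+2≤ D (toℕ i) D%3≡2 (toℕ<n i) ⟩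
    D              ≤⟨ geodesic-index-bound geo (3 * toℕ i) D ≤-refl w-to-end ⟩
    3 * toℕ i + m  ∎)
    where
      open ≤-Reasoning
      w-to-end : Walk E (milestone i) (at (proj₁ geo) D) m
      w-to-end = subst (λ x → Walk E (milestone i) x m) (sym (at-end (proj₁ geo))) w

geodesic⇒packing : {V : Set} {E : V → V → Set} → Symmetric E →
  ∀ {u v D} → IsDist E u v D → HasPacking E (η D)
geodesic⇒packing E-sym geo = milestones , milestones-packing , length-milestones
  where open Milestones E-sym geo

unique-neighbour⇒adjacent : {V : Set} {E : V → V → Set} → Symmetric E →
  (∀ {x a b} → E x a → E x b → a ≡ b) → ∀ {u v k} → Walk E u v k → v ≡ u ⊎ E u v
unique-neighbour⇒adjacent E-sym unique [] = inj₁ refl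
unique-neighbour⇒adjacent E-sym unique (e ∷ W) with unique-neighbour⇒adjacent E-sym unique W
... | inj₁ refl = inj₂ e
... | inj₂ e′   = inj₁ (sym (unique (E-sym e) e′))

complete-unique-neighbour⇒≤2 : ∀ {n} (E : Fin n → Fin n → Set) → (∀ u v → u ≢ v → E u v) →
  (∀ {x a b} → E x a → E x b → a ≡ b) → n ≤ 2
complete-unique-neighbour⇒≤2 {0}               _ _        _      = z≤n
complete-unique-neighbour⇒≤2 {1}               _ _        _      = s≤s z≤n
complete-unique-neighbour⇒≤2 {2}               _ _        _      = ≤-refl
complete-unique-neighbour⇒≤2 {suc (suc (suc _))} _ complete unique
  with unique (complete zero (suc zero) λ ()) (complete zero (suc (suc zero)) λ ())
... | ()

∃∉openPacking : (G : Graph) → n G ≥ 2 → Connected (_~_ G) → ¬ IsK2 G →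
  ∀ {P} → IsOpenPacking (_~_ G) P → ∃ λ x → ¬ x ∈ P
∃∉openPacking G n≥2 connected G≢K₂ {P} (_ , disjoint) =
  ¬∀⟶∃¬ (n G) (_∈ P) (λ x → _∈?_ _≟ᶠ_ x P) P-not-covering
  where
    P-not-covering : (∀ x → x ∈ P) → ⊥
    P-not-covering all∈ = G≢K₂ (≤-antisym (complete-unique-neighbour⇒≤2 (_~_ G) complete unique) n≥2 , complete)
      where
        unique : ∀ {x a b} → _~_ G x a → _~_ G x b → a ≡ b
        unique {x} {a} {b} xa xb with a ≟ᶠ b
        ... | yes a≡b = a≡b
        ... | no  a≢b = ⊥-elim (disjoint (all∈ a) (all∈ b) a≢b x (~-sym G xa , ~-sym G xb))
        complete : ∀ u v → u ≢ v → _~_ G u v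
        complete u v u≢v with unique-neighbour⇒adjacent (~-sym G) unique (proj₂ (connected u v))
        ... | inj₁ v≡u = ⊥-elim (u≢v (sym v≡u))
        ... | inj₂ uv  = uv

length-cartesianProduct : {A B : Set} (xs : List A) (ys : List B) →
  length (cartesianProduct xs ys) ≡ length xs * length ys
length-cartesianProduct []       ys = refl
length-cartesianProduct (x ∷ xs) ys = begin
  length (map (x ,_) ys ++ cartesianProduct xs ys)          ≡⟨ length-++ (map (x ,_) ys) ⟩
  length (map (x ,_) ys) + length (cartesianProduct xs ys)  ≡⟨ cong₂ _+_ (length-map (x ,_) ys) (length-cartesianProduct xs ys) ⟩
  length ys + length xs * length ys                         ∎
  where open ≡-Reasoning

∷⁺-openPacking : {V : Set} {E : V → V → Set} {x : V} {L : List V} → ¬ x ∈ L →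
  (∀ {y} → y ∈ L → ∀ w → ¬ (E x w × E y w)) → IsOpenPacking E L → IsOpenPacking E (x ∷ L)
∷⁺-openPacking {E = E} {x} {L} x∉L x-far (unique , disjoint) = ¬Any⇒All¬ L x∉L ∷ unique , disjoint′
  where
    disjoint′ : ∀ {a b} → a ∈ x ∷ L → b ∈ x ∷ L → a ≢ b → ∀ w → ¬ (E a w × E b w)
    disjoint′ (here refl) (here refl) a≢b _ _          = a≢b refl
    disjoint′ (here refl) (there b∈)  _   w (xw , bw)  = x-far b∈ w (xw , bw)
    disjoint′ (there a∈)  (here refl) _   w (aw , xw)  = x-far a∈ w (xw , aw)
    disjoint′ (there a∈)  (there b∈)  a≢b w            = disjoint a∈ b∈ a≢b w

map⁺-openPacking : {V W : Set} {E : V → V → Set} {F : W → W → Set} (f : V → W) (g : W → V) →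
  (∀ {x y} → f x ≡ f y → x ≡ y) → (∀ {v w} → F (f v) w → E v (g w)) →
  ∀ {L} → IsOpenPacking E L → IsOpenPacking F (map f L)
map⁺-openPacking {F = F} f g f-injective reflect {L} (unique , disjoint) =
  map⁺ f-injective unique , disjoint′
  where
    disjoint′ : ∀ {a b} → a ∈ map f L → b ∈ map f L → a ≢ b → ∀ w → ¬ (F a w × F b w)
    disjoint′ a∈ b∈ a≢b w (aw , bw) with ∈-map⁻ f a∈ | ∈-map⁻ f b∈
    ... | _ , a∈L , refl | _ , b∈L , refl =
      disjoint a∈L b∈L (λ e → a≢b (cong f e)) (g w) (reflect aw , reflect bw)

swap-openPacking : (G H : Graph) → ∀ {L} →
  IsOpenPacking (□-Adj G H) L → IsOpenPacking (□-Adj H G) (map swap L)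
swap-openPacking G H = map⁺-openPacking swap swap (cong swap) swap-adj
  where
    swap-adj : ∀ {v w} → □-Adj H G (swap v) w → □-Adj G H v (swap w)
    swap-adj {_ , _} {_ , _} (inj₁ p) = inj₂ p
    swap-adj {_ , _} {_ , _} (inj₂ p) = inj₁ p

module _ (G H : Graph) where

  private
    _~G_ = _~_ G
    _~H_ = _~_ H

  □-common-neighbour : ∀ {g h g′ h′ w} → □-Adj G H (g , h) w → □-Adj G H (g′ , h′) w →
    (g ≡ g′ × ∃ λ z → h ~H z × h′ ~H z) ⊎
    (g ~G g′ × h ~H h′) ⊎
    (h ≡ h′ × ∃ λ z → g ~G z × g′ ~G z)
  □-common-neighbour (inj₁ (refl , p)) (inj₁ (refl , q)) = inj₁ (refl , _ , p , q)
  □-common-neighbour (inj₁ (refl , p)) (inj₂ (refl , q)) = inj₂ (inj₁ (~-sym G q , p))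
  □-common-neighbour (inj₂ (refl , p)) (inj₁ (refl , q)) = inj₂ (inj₁ (p , ~-sym H q))
  □-common-neighbour (inj₂ (refl , p)) (inj₂ (refl , q)) = inj₂ (inj₂ (refl , _ , p , q))

  packing×openPacking : ∀ {Q P} → IsPacking _~G_ Q → IsOpenPacking _~H_ P →
    IsOpenPacking (□-Adj G H) (cartesianProduct Q P)
  packing×openPacking {Q} {P} (Q-unique , Q-disjoint) (P-unique , P-disjoint) =
    cartesianProduct⁺ Q-unique P-unique , disjoint
    where
      disjoint : ∀ {a b} → a ∈ cartesianProduct Q P → b ∈ cartesianProduct Q P → a ≢ b →
                 ∀ w → ¬ (□-Adj G H a w × □-Adj G H b w)
      disjoint a∈ b∈ a≢b w (aw , bw)
        with ∈-cartesianProductWith⁻ _,_ Q P a∈ | ∈-cartesianProductWith⁻ _,_ Q P b∈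
      ... | g , h , g∈ , h∈ , refl | g′ , h′ , g′∈ , h′∈ , refl with □-common-neighbour aw bw
      ... | inj₁ (refl , z , hz , h′z) =
            P-disjoint h∈ h′∈ (λ e → a≢b (cong (g ,_) e)) z (hz , h′z)
      ... | inj₂ (inj₁ (gg′ , _)) =
            Q-disjoint g∈ g′∈ (λ { refl → ~-irr G gg′ }) g′ (inj₂ gg′ , inj₁ refl)
      ... | inj₂ (inj₂ (refl , z , gz , g′z)) =
            Q-disjoint g∈ g′∈ (λ e → a≢b (cong (_, h) e)) z (inj₂ gz , inj₂ g′z)

  ∷⁺-packing×openPacking : ∀ {Q P y x} → IsPacking _~G_ Q → IsOpenPacking _~H_ P →
    (∀ {q} → q ∈ Q → ¬ InClosedNbhd _~G_ q y) → ¬ x ∈ P →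
    IsOpenPacking (□-Adj G H) ((y , x) ∷ cartesianProduct Q P)
  ∷⁺-packing×openPacking {Q} {P} {y} {x} Q-packing P-openPacking y-far x∉P =
    ∷⁺-openPacking outside far (packing×openPacking Q-packing P-openPacking)
    where
      outside : ¬ (y , x) ∈ cartesianProduct Q P
      outside yx∈ with ∈-cartesianProductWith⁻ _,_ Q P yx∈
      ... | _ , _ , _ , x∈P , refl = x∉P x∈P
      far : ∀ {b} → b ∈ cartesianProduct Q P → ∀ w → ¬ (□-Adj G H (y , x) w × □-Adj G H b w)
      far b∈ w (yxw , bw) with ∈-cartesianProductWith⁻ _,_ Q P b∈
      ... | g , h , g∈ , h∈ , refl with □-common-neighbour yxw bw
      ... | inj₁ (y≡g , _)          = y-far g∈ (inj₁ y≡g)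
      ... | inj₂ (inj₁ (yg , _))    = y-far g∈ (inj₂ (~-sym G yg))
      ... | inj₂ (inj₂ (refl , _))  = x∉P h∈

  ρo-□-comm : ∀ {k} → IsOpenPackingNumber (□-Adj G H) k → IsOpenPackingNumber (□-Adj H G) k
  ρo-□-comm ((L , L-openPacking , L-length) , maximal) =
    (map swap L , swap-openPacking G H L-openPacking , trans (length-map swap L) L-length) ,
    λ L′ L′-openPacking → subst (_≤ _) (length-map swap L′) (maximal _ (swap-openPacking H G L′-openPacking))

  ρo-□-≥-ρ*ρo : ∀ {k q p} → IsOpenPackingNumber (□-Adj G H) k →
    HasPacking _~G_ q → HasOpenPacking _~H_ p → q * p ≤ k
  ρo-□-≥-ρ*ρo (_ , maximal) (Q , Q-packing , refl) (P , P-openPacking , refl) =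
    subst (_≤ _) (length-cartesianProduct Q P) (maximal _ (packing×openPacking Q-packing P-openPacking))

  ρo-□-≥-η*ρo+1 : ∀ {k u v D p} → IsOpenPackingNumber (□-Adj G H) k →
    IsDist _~G_ u v D → D % 3 ≡ 2 →
    (P : HasOpenPacking _~H_ p) → ∃ (λ x → ¬ x ∈ proj₁ P) → η D * p + 1 ≤ k
  ρo-□-≥-η*ρo+1 {k} {D = D} (_ , maximal) geo D%3≡2 (P , P-openPacking , refl) (x , x∉P) =
    subst (_≤ k) size (maximal _ (∷⁺-packing×openPacking milestones-packing P-openPacking
                                    (milestones-far-from-end D%3≡2) x∉P))
    where
      open Milestones (~-sym G) geo
      size : suc (length (cartesianProduct milestones P)) ≡ η D * length P + 1
      size = trans (cong suc (trans (length-cartesianProduct milestones P)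
                                    (cong (_* length P) length-milestones)))
                   (+-comm 1 _)

theorem3 : (G H : Graph) → n G ≥ 2 → n H ≥ 2 →
    Connected (_~_ G) → Connected (_~_ H) →
    (ρG ρH ρoG ρoH ρoGH dG dH : ℕ) →
    IsPackingNumber (_~_ G) ρG → IsPackingNumber (_~_ H) ρH →
    IsOpenPackingNumber (_~_ G) ρoG → IsOpenPackingNumber (_~_ H) ρoH →
    IsOpenPackingNumber (□-Adj G H) ρoGH →
    IsDiam (_~_ G) dG → IsDiam (_~_ H) dH →
    (ρG * ρoH ≤ ρoGH) × (ρH * ρoG ≤ ρoGH) ×
    (η dH * ρoG ≤ ρoGH) × (η dG * ρoH ≤ ρoGH) ×
    (¬ IsK2 G → dH % 3 ≡ 2 → η dH * ρoG + 1 ≤ ρoGH) ×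
    (¬ IsK2 H → dG % 3 ≡ 2 → η dG * ρoH + 1 ≤ ρoGH)
theorem3 G H |G|≥2 |H|≥2 G-connected H-connected ρG ρH ρoG ρoH ρoGH dG dH
  (packG , _) (packH , _) (openG , _) (openH , _) ρoGH-max
  ((_ , _ , diamG) , _) ((_ , _ , diamH) , _) =
    ρo-□-≥-ρ*ρo G H ρoGH-max packG openH ,
    ρo-□-≥-ρ*ρo H G ρoHG-max packH openG ,
    ρo-□-≥-ρ*ρo H G ρoHG-max (geodesic⇒packing (~-sym H) diamH) openG ,
    ρo-□-≥-ρ*ρo G H ρoGH-max (geodesic⇒packing (~-sym G) diamG) openH ,
    (λ G≢K₂ dH%3≡2 → ρo-□-≥-η*ρo+1 H G ρoHG-max diamH dH%3≡2 openG
                       (∃∉openPacking G |G|≥2 G-connected G≢K₂ (proj₁ (proj₂ openG)))) ,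
    (λ H≢K₂ dG%3≡2 → ρo-□-≥-η*ρo+1 G H ρoGH-max diamG dG%3≡2 openH
                       (∃∉openPacking H |H|≥2 H-connected H≢K₂ (proj₁ (proj₂ openH))))
  where
    ρoHG-max : IsOpenPackingNumber (□-Adj H G) ρoGH
    ρoHG-max = ρo-□-comm G H ρoGH-max
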